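{- Let $\Lambda$ be a set of $\mathit{LTL}$-formulas, $A$ an $\mathit{LTL}$-formula, and $\Lambda^*=\{B^*\mid B\in\Lambda\}$. Then $\Lambda\models_{\mathit{LTL}} A$ if and only if $\Lambda^*\models_{\nabla} A^*$.
   Context: Fix a set $\mathcal{P}$ of propositional symbols. $\mathit{LTL}$-formulas: $A ::= p \mid \bot \mid A\supset A \mid \mathsf{G}A \mid \mathsf{X}A \mid A\,\mathsf{U}\,A$ ($p\in\mathcal{P}$). $\mathit{LTL}_\nabla$-formulas: $A ::= p \mid \bot \mid A\supset A \mid \mathsf{G}A \mid \mathsf{X}A \mid \nabla A$. In both languages $\neg A := A\supset\bot$, $A\vee B := \neg A\supset B$, $A\wedge B := \neg(\neg A\vee\neg B)$, $\mathsf{F}A := \neg\mathsf{G}\neg A$. An $\mathit{LTL}$-model is $\mathcal{M}=\langle \mathbb{N},\mathcal{V}\rangle$ with $\mathcal{V}:\mathbb{N}\to 2^{\mathcal{P}}$. $\mathit{LTL}$-truth: $\mathcal{M},n\models_{\mathit{LTL}} p$ iff $p\in\mathcal{V}(n)$; $\bot$ never true; $\supset$ classical; $\mathcal{M},n\models_{\mathit{LTL}}\mathsf{G}A$ iff $\mathcal{M},m\models_{\mathit{LTL}} A$ for all $m\ge n$; $\mathcal{M},n\models_{\mathit{LTL}}\mathsf{X}A$ iff $\mathcal{M},n+1\models_{\mathit{LTL}} A$; $\mathcal{M},n\models_{\mathit{LTL}} A\,\mathsf{U}\,B$ iff there is $n'\ge n$ with $\mathcal{M},n'\models_{\mathit{LTL}}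 B$ and $\mathcal{M},m\models_{\mathit{LTL}} A$ for all $n\le m<n'$. $\mathcal{M}\models_{\mathit{LTL}}A$ iff $\mathcal{M},n\models_{\mathit{LTL}}A$ for all $n$; $\Lambda\models_{\mathit{LTL}}A$ iff for every $\mathit{LTL}$-model $\mathcal{M}$, if $\mathcal{M}\models_{\mathit{LTL}}B$ for all $B\in\Lambda$ then $\mathcal{M}\models_{\mathit{LTL}}A$. An observation sequence is a non-empty finite sequence $[n_0,\ldots,n_k]$ of natural numbers. Truth $\models_\nabla$ of $\mathit{LTL}_\nabla$-formulas at observation sequences: $\mathcal{M},[n_0,\ldots,n_k]\models_\nabla p$ iff $p\in\mathcal{V}(n_k)$; $\bot$ never true; $\supset$ classical at the same sequence; $\mathcal{M},[n_0,\ldots,n_k]\models_\nabla\mathsf{G}A$ iff $\mathcal{M},[n_0,\ldots,n_k,m]\models_\nabla A$ for all $m\ge n_k$; $\mathcal{M},[n_0,\ldots,n_k]\models_\nabla\mathsf{X}A$ iff $\mathcal{M},[n_0,\ldots,n_k,n_k+1]\models_\nabla A$; if $k>0$, $\mathcal{M},[n_0,\ldots,n_{k-1},n_k]\models_\nabla\nabla A$ iff $\mathcal{M},[n_0,\ldots,n_{k-1},m]\models_\nabla A$ for all $n_{k-1}\le m\le n_k$; and $\mathcal{M},[n_0]\models_\nabla\nabla A$ iff $\mathcal{M},[n_0]\models_\nabla A$. $\mathcal{M}\models_\nabla A$ iff $\mathcal{M},\sigma\models_\nabla A$ for every observation sequence $\sigma$; $\Gamma\models_\nabla A$ iff for every $\mathit{LTL}$-model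 $\mathcal{M}$, if $\mathcal{M}\models_\nabla B$ for all $B\in\Gamma$ then $\mathcal{M}\models_\nabla A$. The translation $(\cdot)^*$: $p^*=p$, $\bot^*=\bot$, $(A\supset B)^*=A^*\supset B^*$, $(\mathsf{G}A)^*=\mathsf{G}A^*$, $(\mathsf{X}A)^*=\mathsf{X}A^*$, $(A\,\mathsf{U}\,B)^* = B^*\vee \mathsf{F}(\mathsf{X}B^*\wedge\nabla A^*)$. -}

module Defs where

open import Data.Nat using (ℕ; suc; _≤_)
open import Data.Bool using (Bool; T)
open import Data.Empty using (⊥)
open import Data.Product using (Σ; _×_)
open import Data.List using (List; []; _∷_)
open import Data.List.NonEmpty using (List⁺; _∷_)

module _ (𝒫 : Set) where

  data LTL : Set where
    atom : 𝒫 → LTL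
    ⊥'   : LTL
    _⊃_  : LTL → LTL → LTL
    G    : LTL → LTL
    X    : LTL → LTL
    _U_  : LTL → LTL → LTL

  data LTL∇ : Set where
    atom : 𝒫 → LTL∇
    ⊥'   : LTL∇
    _⊃_  : LTL∇ → LTL∇ → LTL∇
    G    : LTL∇ → LTL∇
    X    : LTL∇ → LTL∇
    ∇    : LTL∇ → LTL∇

  ¬∇ : LTL∇ → LTL∇
  ¬∇ A = A ⊃ ⊥'

  _∨∇_ : LTL∇ → LTL∇ → LTL∇
  A ∨∇ B = ¬∇ A ⊃ B

  _∧∇_ : LTL∇ → LTL∇ → LTL∇
  A ∧∇ B = ¬∇ (¬∇ A ∨∇ ¬∇ B)

  F∇ : LTL∇ → LTL∇
  F∇ A = ¬∇ (G (¬∇ A))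

  -- A model: valuation V : ℕ → 2^𝒫, represented as a characteristic function
  Model : Set
  Model = ℕ → 𝒫 → Bool

  _,_⊨LTL_ : Model → ℕ → LTL → Set
  M , n ⊨LTL atom p = T (M n p)
  M , n ⊨LTL ⊥' = ⊥
  M , n ⊨LTL (A ⊃ B) = M , n ⊨LTL A → M , n ⊨LTL B
  M , n ⊨LTL G A = (m : ℕ) → n ≤ m → M , m ⊨LTL A
  M , n ⊨LTL X A = M , suc n ⊨LTL A
  M , n ⊨LTL (A U B) =
    Σ ℕ λ n' → n ≤ n' × M , n' ⊨LTL B × ((m : ℕ) → n ≤ m → suc m ≤ n' → M , m ⊨LTL A)

  _⊨LTL_ : Model → LTL → Set
  M ⊨LTL A = (n : ℕ) → M , n ⊨LTL A

  _⊨ᴸ_ : (LTL → Set) → LTL → Set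
  Λ ⊨ᴸ A = (M : Model) → ((B : LTL) → Λ B → M ⊨LTL B) → M ⊨LTL A

  -- Observation sequences [n₀,…,n_k], stored in reverse: the head is the
  -- last element n_k, the tail is [n_{k-1},…,n₀].
  ObsSeq : Set
  ObsSeq = List⁺ ℕ

  _,_⊨∇_ : Model → ObsSeq → LTL∇ → Set
  M , (nk ∷ rest) ⊨∇ atom p = T (M nk p)
  M , σ ⊨∇ ⊥' = ⊥
  M , σ ⊨∇ (A ⊃ B) = M , σ ⊨∇ A → M , σ ⊨∇ B
  M , (nk ∷ rest) ⊨∇ G A = (m : ℕ) → nk ≤ m → M , (m ∷ (nk ∷ rest)) ⊨∇ A
  M , (nk ∷ rest) ⊨∇ X A = M , (suc nk ∷ (nk ∷ rest)) ⊨∇ A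
  M , (nk ∷ []) ⊨∇ ∇ A = M , (nk ∷ []) ⊨∇ A
  M , (nk ∷ (nk-1 ∷ rest)) ⊨∇ ∇ A =
    (m : ℕ) → nk-1 ≤ m → m ≤ nk → M , (m ∷ (nk-1 ∷ rest)) ⊨∇ A

  _⊨∇_ : Model → LTL∇ → Set
  M ⊨∇ A = (σ : ObsSeq) → M , σ ⊨∇ A

  _⊨ᴺ_ : (LTL∇ → Set) → LTL∇ → Set
  Γ ⊨ᴺ A = (M : Model) → ((B : LTL∇) → Γ B → M ⊨∇ B) → M ⊨∇ A

  _* : LTL → LTL∇
  atom p * = atom p
  ⊥' * = ⊥'
  (A ⊃ B) * = (A *) ⊃ (B *)
  G A * = G (A *)
  X A * = X (A *)
  (A U B) * = (B *) ∨∇ F∇ (X (B *) ∧∇ ∇ (A *))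

  image* : (LTL → Set) → (LTL∇ → Set)
  image* Λ C = Σ LTL λ B → Λ B × (B *) ≡ C
    where open import Relation.Binary.PropositionalEquality using (_≡_)

-- The truth of A* at an observation sequence depends only on its last
-- element n, and coincides with the truth of A at n. Earlier observations
-- matter only through ∇, which in the image of A U B occurs solely in
-- F(X B* ∧ ∇A*): evaluated at [.., n, m] it says that A holds on [n, m], so
-- the translation of A U B reads "B at n, or B at some m+1 ≥ n+1 with A on
-- [n, m]", which is exactly the unfolding of U. Hence M ⊨LTL A iff M ⊨∇ A*,
-- and the two consequence relations agree. The derived connectives ∨, ∧, F
-- of the paper only have their intended meaning classically, whence the
-- excluded middle.
module Submission where

open import Defs
open import Axiom.ExcludedMiddle using (ExcludedMiddle)
open import Axiom.DoubleNegationElimination using (DoubleNegationElimination; em⇒dne)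
open import Data.Empty using (⊥-elim)
open import Data.List using ([]; _∷_)
open import Data.List.NonEmpty using (_∷_)
open import Data.Nat using (ℕ; suc; _≤_; s≤s)
open import Data.Nat.Properties using (≤-refl; ≤⇒≯; m≤n⇒m<n∨m≡n; m≤n⇒m≤1+n)
open import Data.Product using (∃-syntax; _×_; _,_)
open import Data.Product.Function.NonDependent.Propositional using (_×-⇔_)
open import Data.Product.Function.Dependent.Propositional using (congˡ)
open import Data.Sum using (_⊎_; inj₁; inj₂; [_,_])
open import Data.Sum.Function.Propositional using (_⊎-⇔_)
open import Function.Bundles using (_⇔_; mk⇔; Equivalence)
open import Function.Construct.Identity using (⇔-id)
open import Function.Construct.Symmetry using (⇔-sym)
open import Function.Related.Propositional using (module EquationalReasoning)
open import Function.Related.TypeIsomorphisms using (→-cong-⇔)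
open import Level using (0ℓ)
open import Relation.Binary.PropositionalEquality using (refl)
open import Relation.Nullary using (¬_; yes; no; contradiction)

open Equivalence using (to; from)

Π-cong-⇔ : {I : Set} {P Q : I → Set} → (∀ i → P i ⇔ Q i) → (∀ i → P i) ⇔ (∀ i → Q i)
Π-cong-⇔ P⇔Q = mk⇔ (λ f i → to (P⇔Q i) (f i)) (λ g i → from (P⇔Q i) (g i))

module Classical (em : ExcludedMiddle 0ℓ) where

  private
    dne : DoubleNegationElimination 0ℓ
    dne = em⇒dne em

  ¬→⇔⊎ : {P Q : Set} → (¬ P → Q) ⇔ (P ⊎ Q)
  ¬→⇔⊎ {P} = mk⇔ to′ [ (λ p ¬p → contradiction p ¬p) , (λ q _ → q) ]
    where
      to′ : ∀ {Q} → (¬ P → Q) → P ⊎ Q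
      to′ f with em {P}
      ... | yes p = inj₁ p
      ... | no ¬p = inj₂ (f ¬p)

  ¬[¬¬→¬]⇔× : {P Q : Set} → (¬ (¬ ¬ P → ¬ Q)) ⇔ (P × Q)
  ¬[¬¬→¬]⇔× = mk⇔
    (λ h → dne (λ ¬p → h (λ ¬¬p → contradiction ¬p ¬¬p)) , dne (λ ¬q → h (λ _ → ¬q)))
    (λ (p , q) f → f (λ ¬p → ¬p p) q)

  ¬∀¬⇔∃ : {I : Set} {R P : I → Set} → (¬ (∀ i → R i → ¬ P i)) ⇔ (∃[ i ] R i × P i)
  ¬∀¬⇔∃ = mk⇔ (λ h → dne (λ ¬∃ → h (λ i r p → ¬∃ (i , r , p)))) (λ (i , r , p) f → f i r p)

module Semantics {𝒫 : Set} (M : Model 𝒫) where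

  infix 4 _⊨_ _⊩_

  _⊨_ : ℕ → LTL 𝒫 → Set
  n ⊨ A = _,_⊨LTL_ 𝒫 M n A

  _⊩_ : ObsSeq 𝒫 → LTL∇ 𝒫 → Set
  σ ⊩ A = _,_⊨∇_ 𝒫 M σ A

  U⇔unfolding : ∀ {n} A B →
    n ⊨ A U B ⇔ (n ⊨ B ⊎ ∃[ m ] n ≤ m × suc m ⊨ B × (∀ k → n ≤ k → k ≤ m → k ⊨ A))
  U⇔unfolding {n} A B = mk⇔ unfold fold
    where
      unfold : n ⊨ A U B → n ⊨ B ⊎ ∃[ m ] n ≤ m × suc m ⊨ B × (∀ k → n ≤ k → k ≤ m → k ⊨ A)
      unfold (n' , n≤n' , b , as) with m≤n⇒m<n∨m≡n n≤n'
      ... | inj₂ refl = inj₁ b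
      ... | inj₁ (s≤s n≤m) = inj₂ (_ , n≤m , b , λ k n≤k k≤m → as k n≤k (s≤s k≤m))

      fold : n ⊨ B ⊎ ∃[ m ] n ≤ m × suc m ⊨ B × (∀ k → n ≤ k → k ≤ m → k ⊨ A) → n ⊨ A U B
      fold (inj₁ b) = n , ≤-refl , b , λ m n≤m m<n → ⊥-elim (≤⇒≯ n≤m m<n)
      fold (inj₂ (m , n≤m , b , as)) =
        suc m , m≤n⇒m≤1+n n≤m , b , λ { k n≤k (s≤s k≤m) → as k n≤k k≤m }

  module _ (em : ExcludedMiddle 0ℓ) where
    open Classical em
    open EquationalReasoning

    *-correct : ∀ A n r → (n ∷ r) ⊩ _* 𝒫 A ⇔ n ⊨ A
    *-correct (atom p) n r = ⇔-id _
    *-correct ⊥' n r = ⇔-id _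
    *-correct (A ⊃ B) n r = →-cong-⇔ (*-correct A n r) (*-correct B n r)
    *-correct (G A) n r = Π-cong-⇔ λ m → →-cong-⇔ (⇔-id _) (*-correct A m (n ∷ r))
    *-correct (X A) n r = *-correct A (suc n) (n ∷ r)
    *-correct (A U B) n r = begin
      (n ∷ r) ⊩ _∨∇_ 𝒫 B* (F∇ 𝒫 Step)
        ∼⟨ ¬→⇔⊎ ⟩
      ((n ∷ r) ⊩ B* ⊎ (n ∷ r) ⊩ F∇ 𝒫 Step)
        ∼⟨ *-correct B n r ⊎-⇔ ¬∀¬⇔∃ ⟩
      (n ⊨ B ⊎ (∃[ m ] n ≤ m × (m ∷ n ∷ r) ⊩ Step))
        ∼⟨ ⇔-id _ ⊎-⇔ congˡ (⇔-id _ ×-⇔ step-correct) ⟩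
      (n ⊨ B ⊎ (∃[ m ] n ≤ m × suc m ⊨ B × (∀ k → n ≤ k → k ≤ m → k ⊨ A)))
        ∼⟨ ⇔-sym (U⇔unfolding A B) ⟩
      n ⊨ A U B ∎
      where
        A* B* Step : LTL∇ 𝒫
        A* = _* 𝒫 A
        B* = _* 𝒫 B
        Step = _∧∇_ 𝒫 (X B*) (∇ A*)

        step-correct : ∀ {m} → (m ∷ n ∷ r) ⊩ Step ⇔ (suc m ⊨ B × (∀ k → n ≤ k → k ≤ m → k ⊨ A))
        step-correct {m} = begin
          (m ∷ n ∷ r) ⊩ Step
            ∼⟨ ¬[¬¬→¬]⇔× ⟩
          ((suc m ∷ m ∷ n ∷ r) ⊩ B* × (∀ k → n ≤ k → k ≤ m → (k ∷ n ∷ r) ⊩ A*))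
            ∼⟨ *-correct B (suc m) (m ∷ n ∷ r) ×-⇔
                 Π-cong-⇔ (λ k → →-cong-⇔ (⇔-id _) (→-cong-⇔ (⇔-id _) (*-correct A k (n ∷ r)))) ⟩
          (suc m ⊨ B × (∀ k → n ≤ k → k ≤ m → k ⊨ A)) ∎

    *-valid⇔valid : ∀ A → _⊨∇_ 𝒫 M (_* 𝒫 A) ⇔ _⊨LTL_ 𝒫 M A
    *-valid⇔valid A = mk⇔
      (λ M⊨A* n → to (*-correct A n []) (M⊨A* (n ∷ [])))
      (λ { M⊨A (n ∷ r) → from (*-correct A n r) (M⊨A n) })

theorem1 : ExcludedMiddle 0ℓ → (𝒫 : Set) → (Λ : LTL 𝒫 → Set) → (A : LTL 𝒫) →
    _⊨ᴸ_ 𝒫 Λ A ⇔ _⊨ᴺ_ 𝒫 (image* 𝒫 Λ) (_* 𝒫 A)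
theorem1 em 𝒫 Λ A = mk⇔
  (λ Λ⊨A M M⊨Λ* → from (valid M A)
     (Λ⊨A M λ B ΛB → to (valid M B) (M⊨Λ* (_* 𝒫 B) (B , ΛB , refl))))
  (λ Λ*⊨A* M M⊨Λ → to (valid M A)
     (Λ*⊨A* M λ { _ (B , ΛB , refl) → from (valid M B) (M⊨Λ B ΛB) }))
  where
    valid : ∀ M B → _⊨∇_ 𝒫 M (_* 𝒫 B) ⇔ _⊨LTL_ 𝒫 M B
    valid M = Semantics.*-valid⇔valid M em
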